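{- Let $i\ge0$, $l\ge1$, $j\ge0$, $j_1,\dots,j_l\ge0$ and $k\ge0$ be integers. Then (a) $b_{i,j_1+\cdots+j_l,k}=\sum\binom{i}{i_1,\dots,i_{l+k}}\prod_{r=1}^{l}b_{i_r,j_r,0}$, where the sum runs over all integers $i_1,\dots,i_{l+k}\ge0$ with $i_1+\cdots+i_{l+k}=i$; (b) $b_{i,j,k}=\sum\binom{i}{i_1,\dots,i_{j+k}}$, where the sum runs over all integers $i_1,\dots,i_{j+k}\ge0$ with $i_1+\cdots+i_{j+k}=i$ and $i_1>0,\dots,i_j>0$.
   Context: For integers $i\ge0$, $j\ge0$ and real $k$, $b_{i,j,k}=\sum_{r=0}^{j}\binom{j}{r}(-1)^{j-r}(r+k)^i$, with the convention $0^0=1$. $\binom{i}{i_1,\dots,i_n}$ denotes the multinomial coefficient. -}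

module Defs where

open import Data.Nat as ℕ using (ℕ; zero; suc; _!; NonZero; _∸_)
open import Data.Nat.Properties using (_!≢0; m*n≢0)
open import Data.Nat.Combinatorics using (_C_)
open import Data.Nat.DivMod using (_/_)
open import Data.Integer as ℤ using (ℤ; +_; -_; _+_; _*_; _^_)
open import Data.List as List using (List; []; _∷_; concatMap; upTo)
open import Data.Vec as Vec using (Vec; []; _∷_)
import Data.Vec.Relation.Unary.All as All

Σ< : ℕ → (ℕ → ℤ) → ℤ
Σ< zero    f = + 0
Σ< (suc n) f = Σ< n f + f n

sumℤ : List ℤ → ℤ
sumℤ = List.foldr _+_ (+ 0)

sgn : ℕ → ℤ
sgn zero    = + 1
sgn (suc m) = - sgn m

-- b_{i,j,k} = Σ_{r=0}^{j} C(j,r) (-1)^{j-r} (r+k)^i   (k a nonnegative integer;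
-- Agda's ^ has 0^0 = 1, matching the paper's convention).
b : ℕ → ℕ → ℕ → ℤ
b i j k = Σ< (suc j) (λ r → (+ (j C r)) * (sgn (j ∸ r) * ((+ (r ℕ.+ k)) ^ i)))

vsum : ∀ {n} → Vec ℕ n → ℕ
vsum []       = 0
vsum (x ∷ xs) = x ℕ.+ vsum xs

factProd : ∀ {n} → Vec ℕ n → ℕ
factProd []       = 1
factProd (x ∷ xs) = (x !) ℕ.* factProd xs

factProd≢0 : ∀ {n} (v : Vec ℕ n) → NonZero (factProd v)
factProd≢0 []       = _
factProd≢0 (x ∷ xs) = m*n≢0 (x !) (factProd xs) {{x !≢0}} {{factProd≢0 xs}}

-- Multinomial coefficient  binom(i; i_1,…,i_n) = i! / (i_1! ⋯ i_n!)
-- (used only when i_1+⋯+i_n = i).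
multinomial : ∀ {n} → ℕ → Vec ℕ n → ℕ
multinomial i v = (i ! / factProd v) {{factProd≢0 v}}

boxVecs : (n i : ℕ) → List (Vec ℕ n)
boxVecs zero    i = [] ∷ []
boxVecs (suc n) i = concatMap (λ a → List.map (a ∷_) (boxVecs n i)) (upTo (suc i))

-- All (i_1,…,i_n) ∈ ℕ^n with i_1+⋯+i_n = i  (each such tuple appears exactly once).
compositions : (n i : ℕ) → List (Vec ℕ n)
compositions n i = List.filter (λ v → vsum v ℕ.≟ i) (boxVecs n i)

prodB : ∀ {l} → Vec ℕ l → Vec ℕ l → ℤ
prodB []       []       = + 1
prodB (x ∷ xs) (y ∷ ys) = b x y 0 * prodB xs ys

posPrefixComps : (j k i : ℕ) → List (Vec ℕ (j ℕ.+ k))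
posPrefixComps j k i =
  List.filter (λ v → All.all? (λ x → 0 ℕ.<? x) (Vec.take j v)) (compositions (j ℕ.+ k) i)

-- Let bSeq j k be the sequence s ↦ b s j k, and multiply sequences by binomial convolution
-- (f ⊛ g) s = Σ_{a+c=s} C(s,a) f(a) g(c), which is the product of exponential generating
-- functions.  For ones = (1,1,1,…) and ones⁺ = (0,1,1,…), with generating functions e^x and
-- e^x − 1, the binomial theorem gives ones ⊛ bSeq j k = bSeq j (k+1), and Pascal's rule applied
-- to the forward difference defining b gives ones⁺ ⊛ bSeq j k = bSeq (j+1) k.  So bSeq j k is
-- the convolution of j copies of ones⁺ and k copies of ones (generating function
-- (e^x − 1)^j e^{kx}), and more generally bSeq (j₁+⋯+j_l) k is the convolution of
-- bSeq j₁ 0, …, bSeq j_l 0 and k copies of ones.  An n-fold convolution evaluated at s expands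
-- into a sum over the compositions of s into n parts of a multinomial coefficient times the
-- product of the factors; for these two families of factors this is (a) and (b).
module Submission where

open import Defs
open import Data.Bool using (Bool; true; false; if_then_else_)
open import Data.Nat as ℕ
  using (ℕ; zero; suc; _∸_; _≤_; _<_; _≤′_; _≥_; s≤s; _!; ≤′-refl; ≤′-step)
import Data.Nat.Properties as ℕ
open import Data.Nat.Properties using (_!≢0; _!*_!≢0; m*n≢0)
open import Data.Nat.Combinatorics
  using (_C_; nCk≡n!/k![n-k]!; k![n∸k]!∣n!; nCk+nC[k+1]≡[n+1]C[k+1]; k>n⇒nCk≡0)
open import Data.Nat.DivMod using (m/n*n≡m)
open import Data.Nat.Divisibility using (_∣_; ∣-refl; ∣-trans; *-monoʳ-∣)
import Data.Nat.Tactic.RingSolver as ℕ-Solver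
open import Data.Integer using (ℤ; +_; -_; _+_; _*_; _-_; _^_; 0ℤ; 1ℤ)
import Data.Integer.Properties as ℤ
open import Data.Integer.Tactic.RingSolver using (solve-∀)
open import Data.Fin using (toℕ)
open import Data.Vec.Functional using (Vector)
open import Data.List as List using (List; []; _∷_; [_]; map; filter; concatMap; upTo)
import Data.List.Properties as List
open import Data.Vec as Vec using (Vec; []; _∷_; _++_; replicate; take; drop)
import Data.Vec.Relation.Unary.All as All
open import Data.Product using (_×_; _,_)
open import Function using (id; _∘_; _⇔_; mk⇔)
open import Relation.Nullary.Decidable using (Dec; does; does-⇔; dec-false)
open import Relation.Unary using (Decidable)
open import Relation.Binary.PropositionalEquality
  using (_≡_; _≗_; refl; sym; trans; cong; cong₂; subst; module ≡-Reasoning)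
open import Algebra.Properties.Semiring.Sum ℤ.+-*-semiring
  using (sum; ∑-distrib-+; *-distribˡ-sum; *-distribʳ-sum; sum-replicate-zero)
open import Algebra.Properties.Monoid.Mult ℤ.+-0-monoid using () renaming (_×_ to _·_)
open import Algebra.Properties.Semiring.Exp ℤ.+-*-semiring using () renaming (_^_ to _^ˢ_)
import Algebra.Properties.CommutativeSemiring.Binomial ℤ.+-*-commutativeSemiring as Binomial

open ≡-Reasoning

[m+n]Cm*m!*n!≡[m+n]! : ∀ m n → ((m ℕ.+ n) C m) ℕ.* (m ! ℕ.* n !) ≡ (m ℕ.+ n) !
[m+n]Cm*m!*n!≡[m+n]! m n = begin
    ((m ℕ.+ n) C m) ℕ.* (m ! ℕ.* n !)
  ≡⟨ cong (λ z → ((m ℕ.+ n) C m) ℕ.* (m ! ℕ.* z !)) (sym (ℕ.m+n∸m≡n m n)) ⟩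
    ((m ℕ.+ n) C m) ℕ.* (m ! ℕ.* (m ℕ.+ n ∸ m) !)
  ≡⟨ cong (ℕ._* (m ! ℕ.* (m ℕ.+ n ∸ m) !)) (nCk≡n!/k![n-k]! m≤m+n) ⟩
    ((m ℕ.+ n) ! ℕ./ (m ! ℕ.* (m ℕ.+ n ∸ m) !)) ℕ.* (m ! ℕ.* (m ℕ.+ n ∸ m) !)
  ≡⟨ m/n*n≡m (k![n∸k]!∣n! m≤m+n) ⟩
    (m ℕ.+ n) !
  ∎
  where
  m≤m+n = ℕ.m≤m+n m n
  instance _ = m !* (m ℕ.+ n ∸ m) !≢0

C-trinomial : ∀ a b c →
  ((a ℕ.+ (b ℕ.+ c)) C a) ℕ.* ((b ℕ.+ c) C b)
    ≡ (((a ℕ.+ b) ℕ.+ c) C (a ℕ.+ b)) ℕ.* ((a ℕ.+ b) C a)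
C-trinomial a b c = ℕ.*-cancelʳ-≡ _ _ (a ! ℕ.* (b ! ℕ.* c !)) {{a!*[b!*c!]≢0}} (begin
    C₁ ℕ.* C₂ ℕ.* (a ! ℕ.* (b ! ℕ.* c !))
  ≡⟨ regroup₁ C₁ C₂ (a !) (b !) (c !) ⟩
    C₁ ℕ.* (a ! ℕ.* (C₂ ℕ.* (b ! ℕ.* c !)))
  ≡⟨ cong (λ z → C₁ ℕ.* (a ! ℕ.* z)) ([m+n]Cm*m!*n!≡[m+n]! b c) ⟩
    C₁ ℕ.* (a ! ℕ.* (b ℕ.+ c) !)
  ≡⟨ [m+n]Cm*m!*n!≡[m+n]! a (b ℕ.+ c) ⟩
    (a ℕ.+ (b ℕ.+ c)) !
  ≡⟨ cong _! (sym (ℕ.+-assoc a b c)) ⟩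
    ((a ℕ.+ b) ℕ.+ c) !
  ≡⟨ sym ([m+n]Cm*m!*n!≡[m+n]! (a ℕ.+ b) c) ⟩
    C₃ ℕ.* ((a ℕ.+ b) ! ℕ.* c !)
  ≡⟨ cong (λ z → C₃ ℕ.* (z ℕ.* c !)) (sym ([m+n]Cm*m!*n!≡[m+n]! a b)) ⟩
    C₃ ℕ.* ((C₄ ℕ.* (a ! ℕ.* b !)) ℕ.* c !)
  ≡⟨ regroup₂ C₃ C₄ (a !) (b !) (c !) ⟩
    C₃ ℕ.* C₄ ℕ.* (a ! ℕ.* (b ! ℕ.* c !))
  ∎)
  where
  C₁ = (a ℕ.+ (b ℕ.+ c)) C a
  C₂ = (b ℕ.+ c) C b
  C₃ = ((a ℕ.+ b) ℕ.+ c) C (a ℕ.+ b)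
  C₄ = (a ℕ.+ b) C a
  a!*[b!*c!]≢0 = m*n≢0 (a !) (b ! ℕ.* c !) {{a !≢0}} {{b !* c !≢0}}
  regroup₁ : ∀ x y p q r → x ℕ.* y ℕ.* (p ℕ.* (q ℕ.* r)) ≡ x ℕ.* (p ℕ.* (y ℕ.* (q ℕ.* r)))
  regroup₁ = ℕ-Solver.solve-∀
  regroup₂ : ∀ x y p q r → x ℕ.* ((y ℕ.* (p ℕ.* q)) ℕ.* r) ≡ x ℕ.* y ℕ.* (p ℕ.* (q ℕ.* r))
  regroup₂ = ℕ-Solver.solve-∀

factProd∣vsum! : ∀ {n} (v : Vec ℕ n) → factProd v ∣ vsum v !
factProd∣vsum! []      = ∣-refl
factProd∣vsum! (x ∷ v) = ∣-trans (*-monoʳ-∣ (x !) (factProd∣vsum! v))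
  (subst (λ z → x ! ℕ.* z ! ∣ (x ℕ.+ vsum v) !) (ℕ.m+n∸m≡n x (vsum v))
         (k![n∸k]!∣n! (ℕ.m≤m+n x (vsum v))))

multinomial*factProd : ∀ {n} (v : Vec ℕ n) → multinomial (vsum v) v ℕ.* factProd v ≡ vsum v !
multinomial*factProd v = m/n*n≡m {{factProd≢0 v}} (factProd∣vsum! v)

multinomial-∷ : ∀ {n c} a (v : Vec ℕ n) → vsum v ≡ c →
  multinomial (a ℕ.+ c) (a ∷ v) ≡ ((a ℕ.+ c) C a) ℕ.* multinomial c v
multinomial-∷ a v refl = ℕ.*-cancelʳ-≡ _ _ (factProd (a ∷ v)) {{factProd≢0 (a ∷ v)}} (begin
    multinomial (a ℕ.+ vsum v) (a ∷ v) ℕ.* factProd (a ∷ v)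
  ≡⟨ multinomial*factProd (a ∷ v) ⟩
    (a ℕ.+ vsum v) !
  ≡⟨ sym ([m+n]Cm*m!*n!≡[m+n]! a (vsum v)) ⟩
    κ ℕ.* (a ! ℕ.* vsum v !)
  ≡⟨ cong (λ z → κ ℕ.* (a ! ℕ.* z)) (sym (multinomial*factProd v)) ⟩
    κ ℕ.* (a ! ℕ.* (multinomial (vsum v) v ℕ.* factProd v))
  ≡⟨ regroup κ (a !) (multinomial (vsum v) v) (factProd v) ⟩
    κ ℕ.* multinomial (vsum v) v ℕ.* factProd (a ∷ v)
  ∎)
  where
  κ = (a ℕ.+ vsum v) C a
  regroup : ∀ x p y q → x ℕ.* (p ℕ.* (y ℕ.* q)) ≡ x ℕ.* y ℕ.* (p ℕ.* q)
  regroup = ℕ-Solver.solve-∀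

Σ<-cong : ∀ n {f g : ℕ → ℤ} → (∀ r → r < n → f r ≡ g r) → Σ< n f ≡ Σ< n g
Σ<-cong zero    eq = refl
Σ<-cong (suc n) eq = cong₂ _+_ (Σ<-cong n (λ r r<n → eq r (ℕ.m<n⇒m<1+n r<n))) (eq n (ℕ.n<1+n n))

Σ<-suc : ∀ n (f : ℕ → ℤ) → Σ< (suc n) f ≡ f 0 + Σ< n (f ∘ suc)
Σ<-suc zero    f = ℤ.+-comm 0ℤ (f 0)
Σ<-suc (suc n) f = trans (cong (_+ f (suc n)) (Σ<-suc n f)) (ℤ.+-assoc (f 0) _ _)

Σ<-distrib-+ : ∀ n (f g : ℕ → ℤ) → Σ< n (λ r → f r + g r) ≡ Σ< n f + Σ< n g
Σ<-distrib-+ zero    f g = refl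
Σ<-distrib-+ (suc n) f g =
  trans (cong (_+ (f n + g n)) (Σ<-distrib-+ n f g)) (interchange (Σ< n f) (Σ< n g) (f n) (g n))
  where
  interchange : ∀ w x y z → w + x + (y + z) ≡ w + y + (x + z)
  interchange = solve-∀

Σ<-distribˡ : ∀ n x (f : ℕ → ℤ) → Σ< n (λ r → x * f r) ≡ x * Σ< n f
Σ<-distribˡ zero    x f = sym (ℤ.*-zeroʳ x)
Σ<-distribˡ (suc n) x f =
  trans (cong (_+ x * f n) (Σ<-distribˡ n x f)) (sym (ℤ.*-distribˡ-+ x (Σ< n f) (f n)))

Σ<-neg : ∀ n (f : ℕ → ℤ) → Σ< n (λ r → - f r) ≡ - Σ< n f
Σ<-neg zero    f = refl
Σ<-neg (suc n) f = trans (cong (_+ - f n) (Σ<-neg n f)) (sym (ℤ.neg-distrib-+ (Σ< n f) (f n)))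

Σ<-truncate : ∀ {n m} (f : ℕ → ℤ) → n ≤′ m → (∀ r → n ≤ r → f r ≡ 0ℤ) →
  Σ< m f ≡ Σ< n f
Σ<-truncate f ≤′-refl          vanish = refl
Σ<-truncate f (≤′-step {m} n≤′m) vanish =
  trans (cong₂ _+_ (Σ<-truncate f n≤′m vanish) (vanish m (ℕ.≤′⇒≤ n≤′m))) (ℤ.+-identityʳ _)

-- Antidiagonal sums: Σ₂ s F = Σ_{a+c=s} F a c

Σ₂ : ℕ → (ℕ → ℕ → ℤ) → ℤ
Σ₂ zero    F = F 0 0
Σ₂ (suc s) F = F 0 (suc s) + Σ₂ s (λ a c → F (suc a) c)

Σ₂-cong : ∀ s {F G : ℕ → ℕ → ℤ} → (∀ a c → a ℕ.+ c ≡ s → F a c ≡ G a c) →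
  Σ₂ s F ≡ Σ₂ s G
Σ₂-cong zero    eq = eq 0 0 refl
Σ₂-cong (suc s) eq = cong₂ _+_ (eq 0 (suc s) refl) (Σ₂-cong s (λ a c e → eq (suc a) c (cong suc e)))

antidiagonal : ∀ s → (ℕ → ℕ → ℤ) → Vector ℤ (suc s)
antidiagonal s F k = F (toℕ k) (s ∸ toℕ k)

Σ₂≡sum : ∀ s (F : ℕ → ℕ → ℤ) → Σ₂ s F ≡ sum (antidiagonal s F)
Σ₂≡sum zero    F = sym (ℤ.+-identityʳ (F 0 0))
Σ₂≡sum (suc s) F = cong (_+_ (F 0 (suc s))) (Σ₂≡sum s (λ a c → F (suc a) c))

Σ₂≡Σ< : ∀ s (F : ℕ → ℕ → ℤ) → Σ₂ s F ≡ Σ< (suc s) (λ a → F a (s ∸ a))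
Σ₂≡Σ< zero    F = sym (ℤ.+-identityˡ (F 0 0))
Σ₂≡Σ< (suc s) F =
  trans (cong (_+_ (F 0 (suc s))) (Σ₂≡Σ< s (λ a c → F (suc a) c))) (sym (Σ<-suc (suc s) _))

Σ₂-distrib-+ : ∀ s (F G : ℕ → ℕ → ℤ) → Σ₂ s (λ a c → F a c + G a c) ≡ Σ₂ s F + Σ₂ s G
Σ₂-distrib-+ s F G =
  trans (Σ₂≡sum s _) (trans (∑-distrib-+ (antidiagonal s F) (antidiagonal s G))
    (sym (cong₂ _+_ (Σ₂≡sum s F) (Σ₂≡sum s G))))

Σ₂-distribˡ : ∀ s x (F : ℕ → ℕ → ℤ) → Σ₂ s (λ a c → x * F a c) ≡ x * Σ₂ s F
Σ₂-distribˡ s x F =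
  trans (Σ₂≡sum s _) (trans (sym (*-distribˡ-sum x (antidiagonal s F))) (cong (x *_) (sym (Σ₂≡sum s F))))

Σ₂-distribʳ : ∀ s x (F : ℕ → ℕ → ℤ) → Σ₂ s (λ a c → F a c * x) ≡ Σ₂ s F * x
Σ₂-distribʳ s x F =
  trans (Σ₂≡sum s _) (trans (sym (*-distribʳ-sum x (antidiagonal s F))) (cong (_* x) (sym (Σ₂≡sum s F))))

Σ₂-zero : ∀ s → Σ₂ s (λ _ _ → 0ℤ) ≡ 0ℤ
Σ₂-zero s = trans (Σ₂≡sum s _) (sum-replicate-zero (suc s))

Σ₂-Σ< : ∀ s n (H : ℕ → ℕ → ℕ → ℤ) →
  Σ₂ s (λ a c → Σ< n (λ r → H r a c)) ≡ Σ< n (λ r → Σ₂ s (H r))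
Σ₂-Σ< s zero    H = Σ₂-zero s
Σ₂-Σ< s (suc n) H = trans (Σ₂-distrib-+ s _ (H n)) (cong (_+ Σ₂ s (H n)) (Σ₂-Σ< s n H))

Σ₂-assoc : ∀ s (F : ℕ → ℕ → ℕ → ℤ) →
  Σ₂ s (λ a m → Σ₂ m (λ b c → F a b c)) ≡ Σ₂ s (λ m c → Σ₂ m (λ a b → F a b c))
Σ₂-assoc zero    F = refl
Σ₂-assoc (suc s) F = begin
    Σ₂ (suc s) (λ b c → F 0 b c) + Σ₂ s (λ a m → Σ₂ m (λ b c → F (suc a) b c))
  ≡⟨ cong (_+_ (Σ₂ (suc s) (λ b c → F 0 b c))) (Σ₂-assoc s (λ a → F (suc a))) ⟩
    F 0 0 (suc s) + Σ₂ s (λ b c → F 0 (suc b) c) + Σ₂ s (λ m c → Σ₂ m (λ a b → F (suc a) b c))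
  ≡⟨ ℤ.+-assoc (F 0 0 (suc s)) _ _ ⟩
    F 0 0 (suc s) + (Σ₂ s (λ b c → F 0 (suc b) c) + Σ₂ s (λ m c → Σ₂ m (λ a b → F (suc a) b c)))
  ≡⟨ cong (_+_ (F 0 0 (suc s))) (sym (Σ₂-distrib-+ s _ _)) ⟩
    F 0 0 (suc s) + Σ₂ s (λ m c → Σ₂ (suc m) (λ a b → F a b c))
  ∎

^ˢ≡^ : ∀ x n → x ^ˢ n ≡ x ^ n
^ˢ≡^ x zero    = refl
^ˢ≡^ x (suc n) = cong (x *_) (^ˢ≡^ x n)

·≡* : ∀ n x → n · x ≡ + n * x
·≡* zero    x = sym (ℤ.*-zeroˡ x)
·≡* (suc n) x = trans (cong (_+_ x) (·≡* n x)) (sym (ℤ.suc-* (+ n) x))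

binomial : ∀ x s → (x + 1ℤ) ^ s ≡ Σ₂ s (λ a c → + ((a ℕ.+ c) C a) * x ^ c)
binomial x s = begin
    (x + 1ℤ) ^ s
  ≡⟨ cong (_^ s) (ℤ.+-comm x 1ℤ) ⟩
    (1ℤ + x) ^ s
  ≡⟨ sym (^ˢ≡^ (1ℤ + x) s) ⟩
    (1ℤ + x) ^ˢ s
  ≡⟨ Binomial.theorem s 1ℤ x ⟩
    Binomial.binomialExpansion 1ℤ x s
  ≡⟨ sym (Σ₂≡sum s (λ a c → (s C a) · (1ℤ ^ˢ a * x ^ˢ c))) ⟩
    Σ₂ s (λ a c → (s C a) · (1ℤ ^ˢ a * x ^ˢ c))
  ≡⟨ Σ₂-cong s term ⟩
    Σ₂ s (λ a c → + ((a ℕ.+ c) C a) * x ^ c)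
  ∎
  where
  term : ∀ a c → a ℕ.+ c ≡ s → (s C a) · (1ℤ ^ˢ a * x ^ˢ c) ≡ + ((a ℕ.+ c) C a) * x ^ c
  term a c refl = trans (·≡* ((a ℕ.+ c) C a) _) (cong (+ ((a ℕ.+ c) C a) *_)
    (trans (cong₂ _*_ (trans (^ˢ≡^ 1ℤ a) (ℤ.^-zeroˡ a)) (^ˢ≡^ x c)) (ℤ.*-identityˡ (x ^ c))))

-- Δ j f k is the j-th forward difference of f at k; b i j k is Δ j (_^ i) k.
Δ : ℕ → (ℕ → ℤ) → ℕ → ℤ
Δ j f k = Σ< (suc j) (λ r → + (j C r) * (sgn (j ∸ r) * f (r ℕ.+ k)))

sgn-∸-suc : ∀ {j r} → r < j → sgn (j ∸ r) ≡ - sgn (j ∸ suc r)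
sgn-∸-suc {suc j} {zero}  _         = refl
sgn-∸-suc {suc j} {suc r} (s≤s r<j) = sgn-∸-suc r<j

-- Pascal's rule splits each term of order j + 1: the C(j,r) halves form Δ j f (k + 1), and
-- after shifting r the C(j,r+1) halves form − Δ j f k.
Δ-suc : ∀ j f k → Δ (suc j) f k ≡ Δ j f (suc k) - Δ j f k
Δ-suc j f k = begin
    Δ (suc j) f k
  ≡⟨ Σ<-suc (suc j) _ ⟩
    + 1 * (- sgn j * f k) + Σ< (suc j) (λ r → + (suc j C suc r) * (sgn (j ∸ r) * f (suc r ℕ.+ k)))
  ≡⟨ cong (_+_ (+ 1 * (- sgn j * f k)))
       (trans (Σ<-cong (suc j) (λ r _ → pascal r)) (Σ<-distrib-+ (suc j) _ U)) ⟩
    + 1 * (- sgn j * f k) + (Δ j f (suc k) + (Σ< j U + U j))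
  ≡⟨ cong (λ z → + 1 * (- sgn j * f k) + (Δ j f (suc k) + z)) (cong₂ _+_ tail-cancels last-vanishes) ⟩
    + 1 * (- sgn j * f k) + (Δ j f (suc k) + (- Σ< j V + 0ℤ))
  ≡⟨ regroup (sgn j) (f k) (Δ j f (suc k)) (Σ< j V) ⟩
    Δ j f (suc k) - (+ 1 * (sgn j * f k) + Σ< j V)
  ≡⟨ cong (_-_ (Δ j f (suc k))) (sym (Σ<-suc j _)) ⟩
    Δ j f (suc k) - Δ j f k
  ∎
  where
  U V : ℕ → ℤ
  U r = + (j C suc r) * (sgn (j ∸ r) * f (suc r ℕ.+ k))
  V r = + (j C suc r) * (sgn (j ∸ suc r) * f (suc r ℕ.+ k))
  pascal : ∀ r → + (suc j C suc r) * (sgn (j ∸ r) * f (suc r ℕ.+ k))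
               ≡ + (j C r) * (sgn (j ∸ r) * f (r ℕ.+ suc k)) + U r
  pascal r = begin
      + (suc j C suc r) * X
    ≡⟨ cong (λ z → + z * X) (sym (nCk+nC[k+1]≡[n+1]C[k+1] j r)) ⟩
      + (j C r ℕ.+ j C suc r) * X
    ≡⟨ trans (cong (_* X) (ℤ.pos-+ (j C r) _)) (ℤ.*-distribʳ-+ X (+ (j C r)) (+ (j C suc r))) ⟩
      + (j C r) * X + U r
    ≡⟨ cong (λ n → + (j C r) * (sgn (j ∸ r) * f n) + U r) (sym (ℕ.+-suc r k)) ⟩
      + (j C r) * (sgn (j ∸ r) * f (r ℕ.+ suc k)) + U r
    ∎
    where X = sgn (j ∸ r) * f (suc r ℕ.+ k)
  tail-cancels : Σ< j U ≡ - Σ< j V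
  tail-cancels = trans (Σ<-cong j (λ r r<j → trans
      (cong (λ z → + (j C suc r) * (z * f (suc r ℕ.+ k))) (sgn-∸-suc r<j))
      (negate (+ (j C suc r)) (sgn (j ∸ suc r)) (f (suc r ℕ.+ k)))))
    (Σ<-neg j V)
    where
    negate : ∀ c g y → c * (- g * y) ≡ - (c * (g * y))
    negate = solve-∀
  last-vanishes : U j ≡ 0ℤ
  last-vanishes = trans (cong (λ z → + z * X) (k>n⇒nCk≡0 (ℕ.n<1+n j))) (ℤ.*-zeroˡ X)
    where X = sgn (j ∸ j) * f (suc j ℕ.+ k)
  regroup : ∀ g y d v → + 1 * (- g * y) + (d + (- v + 0ℤ)) ≡ d - (+ 1 * (g * y) + v)
  regroup = solve-∀

-- Binomial convolution of sequences

infixl 7 _⊛_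
_⊛_ : (ℕ → ℤ) → (ℕ → ℤ) → ℕ → ℤ
(f ⊛ g) s = Σ₂ s (λ a c → + ((a ℕ.+ c) C a) * (f a * g c))

δ ones ones⁺ : ℕ → ℤ
δ zero    = 1ℤ
δ (suc _) = 0ℤ
ones _ = 1ℤ
ones⁺ zero    = 0ℤ
ones⁺ (suc _) = 1ℤ

⊛-congˡ : ∀ {f f′} g → f ≗ f′ → f ⊛ g ≗ f′ ⊛ g
⊛-congˡ g f≗f′ s = Σ₂-cong s (λ a c _ → cong (λ y → + ((a ℕ.+ c) C a) * (y * g c)) (f≗f′ a))

⊛-congʳ : ∀ f {g g′} → g ≗ g′ → f ⊛ g ≗ f ⊛ g′
⊛-congʳ f g≗g′ s = Σ₂-cong s (λ a c _ → cong (λ y → + ((a ℕ.+ c) C a) * (f a * y)) (g≗g′ c))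

⊛-identityˡ : ∀ g → δ ⊛ g ≗ g
⊛-identityˡ g zero    = trans (ℤ.*-identityˡ _) (ℤ.*-identityˡ (g 0))
⊛-identityˡ g (suc s) = trans
  (cong₂ _+_ (trans (ℤ.*-identityˡ _) (ℤ.*-identityˡ (g (suc s))))
             (trans (Σ₂-cong s (λ a c _ → trans (cong (+ ((suc a ℕ.+ c) C suc a) *_) (ℤ.*-zeroˡ (g c)))
                                                (ℤ.*-zeroʳ (+ ((suc a ℕ.+ c) C suc a))))) (Σ₂-zero s)))
  (ℤ.+-identityʳ (g (suc s)))

⊛-assoc : ∀ f g h → (f ⊛ g) ⊛ h ≗ f ⊛ (g ⊛ h)
⊛-assoc f g h s = begin
    ((f ⊛ g) ⊛ h) s
  ≡⟨ Σ₂-cong s (λ m c _ → expandˡ m c) ⟩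
    Σ₂ s (λ m c → Σ₂ m (λ a b → T a b c))
  ≡⟨ sym (Σ₂-assoc s T) ⟩
    Σ₂ s (λ a m → Σ₂ m (λ b c → T a b c))
  ≡⟨ sym (Σ₂-cong s (λ a m _ → expandʳ a m)) ⟩
    (f ⊛ (g ⊛ h)) s
  ∎
  where
  -- the multinomial coefficient (a+b+c)! / (a! b! c!)
  coefficient : ℕ → ℕ → ℕ → ℕ
  coefficient a b c = (((a ℕ.+ b) ℕ.+ c) C (a ℕ.+ b)) ℕ.* ((a ℕ.+ b) C a)
  T : ℕ → ℕ → ℕ → ℤ
  T a b c = + coefficient a b c * (f a * (g b * h c))
  fg gh : ℕ → ℕ → ℤ
  fg a b = + ((a ℕ.+ b) C a) * (f a * g b)
  gh b c = + ((b ℕ.+ c) C b) * (g b * h c)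
  expandˡ : ∀ m c → + ((m ℕ.+ c) C m) * ((f ⊛ g) m * h c) ≡ Σ₂ m (λ a b → T a b c)
  expandˡ m c = trans (cong (+ ((m ℕ.+ c) C m) *_) (sym (Σ₂-distribʳ m (h c) fg)))
    (trans (sym (Σ₂-distribˡ m (+ ((m ℕ.+ c) C m)) (λ a b → fg a b * h c))) (Σ₂-cong m term))
    where
    regroup : ∀ x y p q r → x * (y * (p * q) * r) ≡ x * y * (p * (q * r))
    regroup = solve-∀
    term : ∀ a b → a ℕ.+ b ≡ m →
      + ((m ℕ.+ c) C m) * (+ ((a ℕ.+ b) C a) * (f a * g b) * h c) ≡ T a b c
    term a b refl = trans (regroup (+ ((a ℕ.+ b ℕ.+ c) C (a ℕ.+ b))) (+ ((a ℕ.+ b) C a)) (f a) (g b) (h c))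
      (cong (_* (f a * (g b * h c))) (sym (ℤ.pos-* ((a ℕ.+ b ℕ.+ c) C (a ℕ.+ b)) ((a ℕ.+ b) C a))))
  expandʳ : ∀ a m → + ((a ℕ.+ m) C a) * (f a * (g ⊛ h) m) ≡ Σ₂ m (λ b c → T a b c)
  expandʳ a m = trans (cong (+ ((a ℕ.+ m) C a) *_) (sym (Σ₂-distribˡ m (f a) gh)))
    (trans (sym (Σ₂-distribˡ m (+ ((a ℕ.+ m) C a)) (λ b c → f a * gh b c))) (Σ₂-cong m term))
    where
    regroup : ∀ x y p q r → x * (p * (y * (q * r))) ≡ x * y * (p * (q * r))
    regroup = solve-∀
    term : ∀ b c → b ℕ.+ c ≡ m →
      + ((a ℕ.+ m) C a) * (f a * (+ ((b ℕ.+ c) C b) * (g b * h c))) ≡ T a b c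
    term b c refl = trans (regroup (+ ((a ℕ.+ (b ℕ.+ c)) C a)) (+ ((b ℕ.+ c) C b)) (f a) (g b) (h c))
      (cong (_* (f a * (g b * h c)))
        (trans (sym (ℤ.pos-* ((a ℕ.+ (b ℕ.+ c)) C a) ((b ℕ.+ c) C b))) (cong +_ (C-trinomial a b c))))

⊛-distribˡ-* : ∀ f x g → f ⊛ (λ c → x * g c) ≗ λ s → x * (f ⊛ g) s
⊛-distribˡ-* f x g s = trans (Σ₂-cong s (λ a c _ → swap (+ ((a ℕ.+ c) C a)) (f a) x (g c)))
  (Σ₂-distribˡ s x (λ a c → + ((a ℕ.+ c) C a) * (f a * g c)))
  where
  swap : ∀ k y x z → k * (y * (x * z)) ≡ x * (k * (y * z))
  swap = solve-∀

⊛-Σ<ʳ : ∀ f n (g : ℕ → ℕ → ℤ) →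
  f ⊛ (λ c → Σ< n (λ r → g r c)) ≗ λ s → Σ< n (λ r → (f ⊛ g r) s)
⊛-Σ<ʳ f n g s = trans (Σ₂-cong s (λ a c _ → pull (+ ((a ℕ.+ c) C a)) (f a) c))
  (Σ₂-Σ< s n (λ r a c → + ((a ℕ.+ c) C a) * (f a * g r c)))
  where
  pull : ∀ k y c → k * (y * Σ< n (λ r → g r c)) ≡ Σ< n (λ r → k * (y * g r c))
  pull k y c = sym (trans (Σ<-distribˡ n k (λ r → y * g r c)) (cong (k *_) (Σ<-distribˡ n y (λ r → g r c))))

ones⊛pow : ∀ x → ones ⊛ (x ^_) ≗ (x + 1ℤ) ^_
ones⊛pow x s = trans (Σ₂-cong s (λ a c _ → cong (+ ((a ℕ.+ c) C a) *_) (ℤ.*-identityˡ (x ^ c))))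
  (sym (binomial x s))

ones⁺⊛ : ∀ g → ones⁺ ⊛ g ≗ λ s → (ones ⊛ g) s - g s
ones⁺⊛ g zero    = first-term (g 0)
  where
  first-term : ∀ y → + 1 * (0ℤ * y) ≡ + 1 * (1ℤ * y) - y
  first-term = solve-∀
ones⁺⊛ g (suc s) = first-term (g (suc s)) _
  where
  first-term : ∀ y rest → + 1 * (0ℤ * y) + rest ≡ + 1 * (1ℤ * y) + rest - y
  first-term = solve-∀

convolution : ∀ {n} → Vec (ℕ → ℤ) n → ℕ → ℤ
convolution []       = δ
convolution (f ∷ fs) = f ⊛ convolution fs

bSeq : ℕ → ℕ → ℕ → ℤ
bSeq j k s = b s j k

bSeq-0-0 : bSeq 0 0 ≗ δ
bSeq-0-0 zero    = refl
bSeq-0-0 (suc s) = refl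

ones⊛bSeq : ∀ j k → ones ⊛ bSeq j k ≗ bSeq j (suc k)
ones⊛bSeq j k s = trans (⊛-Σ<ʳ ones (suc j) _ s) (Σ<-cong (suc j) (λ r _ → shift r))
  where
  shift : ∀ r → (ones ⊛ (λ c → + (j C r) * (sgn (j ∸ r) * (+ (r ℕ.+ k)) ^ c))) s
              ≡ + (j C r) * (sgn (j ∸ r) * (+ (r ℕ.+ suc k)) ^ s)
  shift r = begin
      (ones ⊛ (λ c → + (j C r) * (sgn (j ∸ r) * (+ (r ℕ.+ k)) ^ c))) s
    ≡⟨ ⊛-distribˡ-* ones (+ (j C r)) _ s ⟩
      + (j C r) * (ones ⊛ (λ c → sgn (j ∸ r) * (+ (r ℕ.+ k)) ^ c)) s
    ≡⟨ cong (+ (j C r) *_) (⊛-distribˡ-* ones (sgn (j ∸ r)) _ s) ⟩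
      + (j C r) * (sgn (j ∸ r) * (ones ⊛ ((+ (r ℕ.+ k)) ^_)) s)
    ≡⟨ cong (λ z → + (j C r) * (sgn (j ∸ r) * z)) (ones⊛pow (+ (r ℕ.+ k)) s) ⟩
      + (j C r) * (sgn (j ∸ r) * (+ (r ℕ.+ k) + 1ℤ) ^ s)
    ≡⟨ cong (λ n → + (j C r) * (sgn (j ∸ r) * (+ n) ^ s))
         (trans (ℕ.+-comm (r ℕ.+ k) 1) (sym (ℕ.+-suc r k))) ⟩
      + (j C r) * (sgn (j ∸ r) * (+ (r ℕ.+ suc k)) ^ s)
    ∎

ones⁺⊛bSeq : ∀ j k → ones⁺ ⊛ bSeq j k ≗ bSeq (suc j) k
ones⁺⊛bSeq j k s = begin
    (ones⁺ ⊛ bSeq j k) s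
  ≡⟨ ones⁺⊛ (bSeq j k) s ⟩
    (ones ⊛ bSeq j k) s - b s j k
  ≡⟨ cong (_- b s j k) (ones⊛bSeq j k s) ⟩
    b s j (suc k) - b s j k
  ≡⟨ sym (Δ-suc j (λ n → (+ n) ^ s) k) ⟩
    b s (suc j) k
  ∎

bSeq-+ : ∀ j j′ k → bSeq (j ℕ.+ j′) k ≗ bSeq j 0 ⊛ bSeq j′ k
bSeq-+ zero    j′ k s = sym (trans (⊛-congˡ (bSeq j′ k) bSeq-0-0 s) (⊛-identityˡ (bSeq j′ k) s))
bSeq-+ (suc j) j′ k s = begin
    b s (suc (j ℕ.+ j′)) k
  ≡⟨ sym (ones⁺⊛bSeq (j ℕ.+ j′) k s) ⟩
    (ones⁺ ⊛ bSeq (j ℕ.+ j′) k) s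
  ≡⟨ ⊛-congʳ ones⁺ (bSeq-+ j j′ k) s ⟩
    (ones⁺ ⊛ (bSeq j 0 ⊛ bSeq j′ k)) s
  ≡⟨ sym (⊛-assoc ones⁺ (bSeq j 0) (bSeq j′ k) s) ⟩
    (ones⁺ ⊛ bSeq j 0 ⊛ bSeq j′ k) s
  ≡⟨ ⊛-congˡ (bSeq j′ k) (ones⁺⊛bSeq j 0) s ⟩
    (bSeq (suc j) 0 ⊛ bSeq j′ k) s
  ∎

convolution-ones : ∀ k → convolution (replicate k ones) ≗ bSeq 0 k
convolution-ones zero    s = sym (bSeq-0-0 s)
convolution-ones (suc k) s = trans (⊛-congʳ ones (convolution-ones k) s) (ones⊛bSeq 0 k s)

convolution-ones⁺-ones : ∀ j k → convolution (replicate j ones⁺ ++ replicate k ones) ≗ bSeq j k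
convolution-ones⁺-ones zero    k s = convolution-ones k s
convolution-ones⁺-ones (suc j) k s =
  trans (⊛-congʳ ones⁺ (convolution-ones⁺-ones j k) s) (ones⁺⊛bSeq j k s)

convolution-bSeq-ones : ∀ {l} (js : Vec ℕ l) k →
  convolution (Vec.map (λ j → bSeq j 0) js ++ replicate k ones) ≗ bSeq (vsum js) k
convolution-bSeq-ones []       k s = convolution-ones k s
convolution-bSeq-ones (j ∷ js) k s =
  trans (⊛-congʳ (bSeq j 0) (convolution-bSeq-ones js k) s) (sym (bSeq-+ j (vsum js) k s))

-- Sums over compositions

Σcomp : (n : ℕ) → ℕ → (Vec ℕ n → ℤ) → ℤ
Σcomp zero    zero    H = H []
Σcomp zero    (suc s) H = 0ℤ
Σcomp (suc n) s       H = Σ₂ s (λ a c → Σcomp n c (λ v → H (a ∷ v)))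

Σcomp-cong : ∀ n s {H H′ : Vec ℕ n → ℤ} → (∀ v → vsum v ≡ s → H v ≡ H′ v) →
  Σcomp n s H ≡ Σcomp n s H′
Σcomp-cong zero    zero    eq = eq [] refl
Σcomp-cong zero    (suc s) eq = refl
Σcomp-cong (suc n) s       eq =
  Σ₂-cong s (λ a c e → Σcomp-cong n c (λ v ev → eq (a ∷ v) (trans (cong (a ℕ.+_) ev) e)))

Σcomp-distribˡ : ∀ n s x (H : Vec ℕ n → ℤ) → Σcomp n s (λ v → x * H v) ≡ x * Σcomp n s H
Σcomp-distribˡ zero    zero    x H = refl
Σcomp-distribˡ zero    (suc s) x H = sym (ℤ.*-zeroʳ x)
Σcomp-distribˡ (suc n) s       x H =
  trans (Σ₂-cong s (λ a c _ → Σcomp-distribˡ n c x _)) (Σ₂-distribˡ s x _)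

prodAt : ∀ {n} → Vec (ℕ → ℤ) n → Vec ℕ n → ℤ
prodAt []       []      = 1ℤ
prodAt (f ∷ fs) (a ∷ v) = f a * prodAt fs v

convolution≡Σcomp : ∀ {n} (fs : Vec (ℕ → ℤ) n) s →
  convolution fs s ≡ Σcomp n s (λ v → + multinomial s v * prodAt fs v)
convolution≡Σcomp []               zero    = refl
convolution≡Σcomp []               (suc s) = refl
convolution≡Σcomp {suc n} (f ∷ fs) s       = Σ₂-cong s term
  where
  term : ∀ a c → a ℕ.+ c ≡ s → + ((a ℕ.+ c) C a) * (f a * convolution fs c)
       ≡ Σcomp n c (λ v → + multinomial s (a ∷ v) * (f a * prodAt fs v))
  term a c refl = begin
      + κ * (f a * convolution fs c)
    ≡⟨ sym (ℤ.*-assoc (+ κ) (f a) _) ⟩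
      + κ * f a * convolution fs c
    ≡⟨ cong (+ κ * f a *_) (convolution≡Σcomp fs c) ⟩
      + κ * f a * Σcomp n c (λ v → + multinomial c v * prodAt fs v)
    ≡⟨ sym (Σcomp-distribˡ n c (+ κ * f a) _) ⟩
      Σcomp n c (λ v → + κ * f a * (+ multinomial c v * prodAt fs v))
    ≡⟨ Σcomp-cong n c (λ v vsum≡c → trans (regroup (+ κ) (f a) _ (prodAt fs v))
         (cong (_* (f a * prodAt fs v)) (trans (sym (ℤ.pos-* κ _)) (cong +_ (sym (multinomial-∷ a v vsum≡c)))))) ⟩
      Σcomp n c (λ v → + multinomial (a ℕ.+ c) (a ∷ v) * (f a * prodAt fs v))
    ∎
    where
    κ = (a ℕ.+ c) C a
    regroup : ∀ x y m p → x * y * (m * p) ≡ x * m * (y * p)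
    regroup = solve-∀

sumℤ-++ : ∀ xs ys → sumℤ (xs List.++ ys) ≡ sumℤ xs + sumℤ ys
sumℤ-++ []       ys = sym (ℤ.+-identityˡ _)
sumℤ-++ (x ∷ xs) ys = trans (cong (_+_ x) (sumℤ-++ xs ys)) (sym (ℤ.+-assoc x _ _))

sumℤ-concatMap : ∀ {A B : Set} (F : A → List B) (G : B → ℤ) xs →
  sumℤ (map G (concatMap F xs)) ≡ sumℤ (map (λ x → sumℤ (map G (F x))) xs)
sumℤ-concatMap F G []       = refl
sumℤ-concatMap F G (x ∷ xs) = trans (cong sumℤ (List.map-++ G (F x) _))
  (trans (sumℤ-++ (map G (F x)) _) (cong (_+_ (sumℤ (map G (F x)))) (sumℤ-concatMap F G xs)))

sumℤ-upTo : ∀ n (f : ℕ → ℤ) → sumℤ (map f (upTo n)) ≡ Σ< n f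
sumℤ-upTo zero    f = refl
sumℤ-upTo (suc n) f = begin
    sumℤ (map f (upTo (suc n)))
  ≡⟨ cong (sumℤ ∘ map f) (sym (List.applyUpTo-∷ʳ id n)) ⟩
    sumℤ (map f (upTo n List.++ [ n ]))
  ≡⟨ trans (cong sumℤ (List.map-++ f (upTo n) _)) (sumℤ-++ (map f (upTo n)) _) ⟩
    sumℤ (map f (upTo n)) + (f n + 0ℤ)
  ≡⟨ cong₂ _+_ (sumℤ-upTo n f) (ℤ.+-identityʳ (f n)) ⟩
    Σ< (suc n) f
  ∎

sumℤ-map-cong : ∀ {A : Set} {f g : A → ℤ} → f ≗ g → ∀ xs → sumℤ (map f xs) ≡ sumℤ (map g xs)
sumℤ-map-cong f≗g xs = cong sumℤ (List.map-cong f≗g xs)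

sumℤ-zeros : ∀ {A : Set} (xs : List A) → sumℤ (map (λ _ → 0ℤ) xs) ≡ 0ℤ
sumℤ-zeros []       = refl
sumℤ-zeros (x ∷ xs) = trans (ℤ.+-identityˡ _) (sumℤ-zeros xs)

when : Bool → ℤ → ℤ
when c z = if c then z else 0ℤ

sumℤ-filter : ∀ {A : Set} {P : A → Set} (P? : Decidable P) (H : A → ℤ) xs →
  sumℤ (map H (filter P? xs)) ≡ sumℤ (map (λ x → when (does (P? x)) (H x)) xs)
sumℤ-filter P? H []       = refl
sumℤ-filter P? H (x ∷ xs) with does (P? x)
... | true  = cong (_+_ (H x)) (sumℤ-filter P? H xs)
... | false = trans (sumℤ-filter P? H xs) (sym (ℤ.+-identityˡ _))

sumℤ-boxVecs : ∀ n B s (H : Vec ℕ n → ℤ) → s ≤ B →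
  sumℤ (map (λ v → when (does (vsum v ℕ.≟ s)) (H v)) (boxVecs n B)) ≡ Σcomp n s H
sumℤ-boxVecs zero    B zero    H _   = ℤ.+-identityʳ (H [])
sumℤ-boxVecs zero    B (suc s) H _   = refl
sumℤ-boxVecs (suc n) B s       H s≤B = begin
    sumℤ (map K (concatMap (λ a → map (a ∷_) (boxVecs n B)) (upTo (suc B))))
  ≡⟨ sumℤ-concatMap (λ a → map (a ∷_) (boxVecs n B)) K (upTo (suc B)) ⟩
    sumℤ (map (λ a → sumℤ (map K (map (a ∷_) (boxVecs n B)))) (upTo (suc B)))
  ≡⟨ sumℤ-upTo (suc B) _ ⟩
    Σ< (suc B) (λ a → sumℤ (map K (map (a ∷_) (boxVecs n B))))
  ≡⟨ Σ<-cong (suc B) (λ a _ → cong sumℤ (sym (List.map-∘ (boxVecs n B)))) ⟩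
    Σ< (suc B) inner
  ≡⟨ Σ<-truncate inner (ℕ.≤⇒≤′ (s≤s s≤B)) beyond ⟩
    Σ< (suc s) inner
  ≡⟨ Σ<-cong (suc s) within ⟩
    Σ< (suc s) (λ a → Σcomp n (s ∸ a) (λ v → H (a ∷ v)))
  ≡⟨ sym (Σ₂≡Σ< s _) ⟩
    Σcomp (suc n) s H
  ∎
  where
  K : Vec ℕ (suc n) → ℤ
  K v = when (does (vsum v ℕ.≟ s)) (H v)
  inner : ℕ → ℤ
  inner a = sumℤ (map (λ v → K (a ∷ v)) (boxVecs n B))
  within : ∀ a → a < suc s → inner a ≡ Σcomp n (s ∸ a) (λ v → H (a ∷ v))
  within a (s≤s a≤s) = trans
    (sumℤ-map-cong (λ v → cong (λ t → when t (H (a ∷ v)))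
      (does-⇔ (moveˡ v a≤s) (a ℕ.+ vsum v ℕ.≟ s) (vsum v ℕ.≟ s ∸ a))) (boxVecs n B))
    (sumℤ-boxVecs n B (s ∸ a) _ (ℕ.≤-trans (ℕ.m∸n≤m s a) s≤B))
    where
    moveˡ : ∀ v → a ≤ s → (a ℕ.+ vsum v ≡ s) ⇔ (vsum v ≡ s ∸ a)
    moveˡ v a≤s = mk⇔ (λ e → trans (sym (ℕ.m+n∸m≡n a (vsum v))) (cong (_∸ a) e))
                      (λ e → trans (cong (a ℕ.+_) e) (ℕ.m+[n∸m]≡n a≤s))
  beyond : ∀ a → suc s ≤ a → inner a ≡ 0ℤ
  beyond a s<a = trans
    (sumℤ-map-cong (λ v → cong (λ t → when t (H (a ∷ v)))
      (dec-false (a ℕ.+ vsum v ℕ.≟ s) (λ e → ℕ.<⇒≢ (ℕ.<-≤-trans s<a (ℕ.m≤m+n a (vsum v))) (sym e))))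
      (boxVecs n B))
    (sumℤ-zeros (boxVecs n B))

sumℤ-compositions : ∀ n s (H : Vec ℕ n → ℤ) → sumℤ (map H (compositions n s)) ≡ Σcomp n s H
sumℤ-compositions n s H = trans (sumℤ-filter _ H (boxVecs n s)) (sumℤ-boxVecs n s s H ℕ.≤-refl)

convolution-expansion : ∀ {n} (fs : Vec (ℕ → ℤ) n) s →
  convolution fs s ≡ sumℤ (map (λ v → + multinomial s v * prodAt fs v) (compositions n s))
convolution-expansion {n} fs s = trans (convolution≡Σcomp fs s) (sym (sumℤ-compositions n s _))

prodAt-++ : ∀ {l k} (gs : Vec (ℕ → ℤ) l) (hs : Vec (ℕ → ℤ) k) v →
  prodAt (gs ++ hs) v ≡ prodAt gs (take l v) * prodAt hs (drop l v)
prodAt-++ []       hs v       = sym (ℤ.*-identityˡ (prodAt hs v))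
prodAt-++ (g ∷ gs) hs (x ∷ v) = trans (cong (g x *_) (prodAt-++ gs hs v)) (sym (ℤ.*-assoc (g x) _ _))

prodAt-ones : ∀ k (v : Vec ℕ k) → prodAt (replicate k ones) v ≡ 1ℤ
prodAt-ones zero    []      = refl
prodAt-ones (suc k) (x ∷ v) = trans (ℤ.*-identityˡ _) (prodAt-ones k v)

prodAt-bSeq : ∀ {l} (js : Vec ℕ l) u → prodAt (Vec.map (λ j → bSeq j 0) js) u ≡ prodB u js
prodAt-bSeq []       []      = refl
prodAt-bSeq (j ∷ js) (x ∷ u) = cong (b x j 0 *_) (prodAt-bSeq js u)

prodAt-bSeq-ones : ∀ {l} k (js : Vec ℕ l) v →
  prodAt (Vec.map (λ j → bSeq j 0) js ++ replicate k ones) v ≡ prodB (take l v) js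
prodAt-bSeq-ones {l} k js v = trans (prodAt-++ (Vec.map (λ j → bSeq j 0) js) _ v)
  (trans (cong₂ _*_ (prodAt-bSeq js (take l v)) (prodAt-ones k (drop l v))) (ℤ.*-identityʳ _))

when-all-positive : ∀ {j} (u : Vec ℕ j) y →
  when (does (All.all? (0 ℕ.<?_) u)) y ≡ y * prodAt (replicate j ones⁺) u
when-all-positive []          y = sym (ℤ.*-identityʳ y)
when-all-positive (zero  ∷ u) y = sym (ℤ.*-zeroʳ y)
when-all-positive (suc x ∷ u) y = trans (when-all-positive u y) (cong (y *_) (sym (ℤ.*-identityˡ _)))

positivePrefix? : ∀ j {k} (v : Vec ℕ (j ℕ.+ k)) → Dec (All.All (0 ℕ.<_) (take j v))
positivePrefix? j v = All.all? (0 ℕ.<?_) (take j v)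

when-positivePrefix : ∀ j k v y →
  when (does (positivePrefix? j v)) y ≡ y * prodAt (replicate j ones⁺ ++ replicate k ones) v
when-positivePrefix j k v y = begin
    when (does (positivePrefix? j v)) y
  ≡⟨ when-all-positive (take j v) y ⟩
    y * P
  ≡⟨ cong (y *_) (sym (trans (cong (P *_) (prodAt-ones k (drop j v))) (ℤ.*-identityʳ P))) ⟩
    y * (P * prodAt (replicate k ones) (drop j v))
  ≡⟨ cong (y *_) (sym (prodAt-++ (replicate j ones⁺) (replicate k ones) v)) ⟩
    y * prodAt (replicate j ones⁺ ++ replicate k ones) v
  ∎
  where P = prodAt (replicate j ones⁺) (take j v)

mainTheorem18 :
    ((i l k : ℕ) → l ≥ 1 → (js : Vec ℕ l) →
      b i (vsum js) k ≡
        sumℤ (map (λ v → + multinomial i v * prodB (take l v) js) (compositions (l ℕ.+ k) i)))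
    × ((i j k : ℕ) →
      b i j k ≡ sumℤ (map (λ v → + multinomial i v) (posPrefixComps j k i)))
mainTheorem18 = partA , partB
  where
  partA : (i l k : ℕ) → l ≥ 1 → (js : Vec ℕ l) →
    b i (vsum js) k ≡ sumℤ (map (λ v → + multinomial i v * prodB (take l v) js) (compositions (l ℕ.+ k) i))
  partA i l k _ js = begin
      b i (vsum js) k
    ≡⟨ sym (convolution-bSeq-ones js k i) ⟩
      convolution factors i
    ≡⟨ convolution-expansion factors i ⟩
      sumℤ (map (λ v → + multinomial i v * prodAt factors v) (compositions (l ℕ.+ k) i))
    ≡⟨ sumℤ-map-cong (λ v → cong (+ multinomial i v *_) (prodAt-bSeq-ones k js v)) (compositions (l ℕ.+ k) i) ⟩
      sumℤ (map (λ v → + multinomial i v * prodB (take l v) js) (compositions (l ℕ.+ k) i))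
    ∎
    where
    factors : Vec (ℕ → ℤ) (l ℕ.+ k)
    factors = Vec.map (λ j → bSeq j 0) js ++ replicate k ones
  partB : (i j k : ℕ) → b i j k ≡ sumℤ (map (λ v → + multinomial i v) (posPrefixComps j k i))
  partB i j k = begin
      b i j k
    ≡⟨ sym (convolution-ones⁺-ones j k i) ⟩
      convolution factors i
    ≡⟨ convolution-expansion factors i ⟩
      sumℤ (map (λ v → + multinomial i v * prodAt factors v) (compositions (j ℕ.+ k) i))
    ≡⟨ sumℤ-map-cong (λ v → sym (when-positivePrefix j k v (+ multinomial i v))) (compositions (j ℕ.+ k) i) ⟩
      sumℤ (map (λ v → when (does (positivePrefix? j v)) (+ multinomial i v)) (compositions (j ℕ.+ k) i))
    ≡⟨ sym (sumℤ-filter (positivePrefix? j) (λ v → + multinomial i v) (compositions (j ℕ.+ k) i)) ⟩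
      sumℤ (map (λ v → + multinomial i v) (posPrefixComps j k i))
    ∎
    where
    factors : Vec (ℕ → ℤ) (j ℕ.+ k)
    factors = replicate j ones⁺ ++ replicate k ones
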